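{- Let $G=(V,E)$ be a finite simple undirected graph and let $\pi\colon V\to\mathcal{C}$ be an equitable coloring of $G$. Let $H$ be the directed graph whose vertex set is the set of colors $\pi(V)$, with an arc $(c_1,c_2)$ for $c_1\neq c_2$ whenever a (equivalently, every) vertex of color $c_1$ has at least one neighbor of color $c_2$. Let $D_1,\ldots,D_t$ be the (weakly) connected components of $H$, and for each $i$ let $V_i:=\pi^{ -1}(D_i)$ be the set of vertices whose color lies in $D_i$. Then $$\operatorname{Aut}(G,\pi)=\prod_{i=1}^{t}\operatorname{Aut}\big((G,\pi)[V_i]\big),$$ that is, a permutation $\varphi$ of $V$ is an automorphism of the colored graph $(G,\pi)$ if and only if $\varphi(V_i)=V_i$ for every $i$ and the restriction $\varphi|_{V_i}$ is an automorphism of the induced colored subgraph $(G,\pi)[V_i]$ for every $i$.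
   Context: A coloring $\pi\colon V\to\mathcal{C}$ is equitable if for all pairs of (not necessarily distinct) color classes $C_1,C_2$, all vertices in $C_1$ have the same number of neighbors in $C_2$. An automorphism of a colored graph $(V,E,\pi)$ is a bijection $\varphi\colon V\to V$ with $\varphi(E)=E$ and $\pi(\varphi(v))=\pi(v)$ for all $v$. For $V'\subseteq V$, the induced colored subgraph $(G,\pi)[V']$ has vertex set $V'$, the edges of $E$ with both endpoints in $V'$, and coloring $\pi|_{V'}$. The graph $H$ is the paper's quotient graph $Q(G,\pi)$ (vertices are the colors of $\pi$, arc $(c_1,c_2)$ labelled by the number of neighbors a vertex of color $c_1$ has of color $c_2$), with arcs of label $0$ and self-loops disregarded. -}

module Defs where

open import Data.Nat using (ℕ)
open import Data.Bool using (Bool; true; false; _∧_; if_then_else_)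
open import Data.Fin using (Fin; _≟_)
open import Data.List using (List; map; allFin)
open import Data.Nat.ListAction using (sum)
open import Data.Product using (Σ; _×_; ∃; ∃-syntax)
open import Relation.Nullary using (¬_)
open import Relation.Nullary.Decidable using (⌊_⌋)
open import Relation.Binary.PropositionalEquality using (_≡_; _≢_)
open import Relation.Binary.Construct.Closure.ReflexiveTransitive using (Star)
open import Relation.Binary.Construct.Closure.Symmetric using (SymClosure)
open import Function.Bundles using (_⇔_)
open import Data.Fin.Permutation using (Permutation′; _⟨$⟩ʳ_)

record Graph (n : ℕ) : Set where
  field
    adj     : Fin n → Fin n → Bool
    sym     : ∀ u v → adj u v ≡ adj v u
    irrefl  : ∀ u → adj u u ≡ false

open Graph public

Edge : ∀ {n} → Graph n → Fin n → Fin n → Set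
Edge G u v = adj G u v ≡ true

Coloring : ℕ → ℕ → Set
Coloring n k = Fin n → Fin k

nbrCount : ∀ {n k} → Graph n → Coloring n k → Fin n → Fin k → ℕ
nbrCount {n} G π u c =
  sum (map (λ w → if adj G u w ∧ ⌊ π w ≟ c ⌋ then 1 else 0) (allFin n))

Equitable : ∀ {n k} → Graph n → Coloring n k → Set
Equitable G π = ∀ c₁ c₂ u v → π u ≡ c₁ → π v ≡ c₁ → nbrCount G π u c₂ ≡ nbrCount G π v c₂

-- arcs of the quotient graph H (arcs with label 0 and self-loops disregarded)
Arc : ∀ {n k} → Graph n → Coloring n k → Fin k → Fin k → Set
Arc G π c₁ c₂ = c₁ ≢ c₂ × ∃[ u ] ∃[ w ] (π u ≡ c₁ × Edge G u w × π w ≡ c₂)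

WConn : ∀ {n k} → Graph n → Coloring n k → Fin k → Fin k → Set
WConn G π = Star (SymClosure (Arc G π))

-- V_D for the weakly connected component D of H containing the color c:
-- vertices whose color lies in D
InPart : ∀ {n k} → Graph n → Coloring n k → Fin k → Fin n → Set
InPart G π c v = WConn G π c (π v)

IsAut : ∀ {n k} → Graph n → Coloring n k → Permutation′ n → Set
IsAut G π φ =
  (∀ u v → Edge G u v ⇔ Edge G (φ ⟨$⟩ʳ u) (φ ⟨$⟩ʳ v)) × (∀ v → π (φ ⟨$⟩ʳ v) ≡ π v)

MapsOnto : ∀ {n} → Permutation′ n → (Fin n → Set) → Set
MapsOnto {n} φ P = (∀ v → P v → P (φ ⟨$⟩ʳ v)) × (∀ w → P w → ∃[ v ] (P v × φ ⟨$⟩ʳ v ≡ w))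

RestrictionIsAut : ∀ {n k} → Graph n → Coloring n k → Permutation′ n → (Fin n → Set) → Set
RestrictionIsAut G π φ P =
  (∀ u v → P u → P v → Edge G u v ⇔ Edge G (φ ⟨$⟩ʳ u) (φ ⟨$⟩ʳ v)) ×
  (∀ v → P v → π (φ ⟨$⟩ʳ v) ≡ π v)

{-# OPTIONS --safe #-}
module Submission where

open import Defs hiding (sym)
open import Data.Fin using (Fin; _≟_)
open import Data.Product using (_×_; _,_; ∃-syntax)
open import Function using (_∘_)
open import Function.Bundles using (_⇔_; mk⇔; Equivalence)
open import Data.Fin.Permutation using (Permutation′; _⟨$⟩ʳ_; _⟨$⟩ˡ_; inverseʳ)
open import Relation.Binary.PropositionalEquality using (_≡_; refl; sym; trans; cong; subst; subst₂)
open import Relation.Nullary using (yes; no)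
open import Relation.Binary.Construct.Closure.ReflexiveTransitive using (ε; _◅_)
open import Relation.Binary.Construct.Closure.Symmetric using (fwd)

-- The parts V_i are unions of color classes and every edge stays inside one part,
-- so a color-preserving permutation respects the parts and its edge condition
-- splits into conditions on the parts.  The arc relation of H is defined by the
-- existence of a single witnessing edge.

module _ {n k} (G : Graph n) (π : Coloring n k) where

  Edge⇒WConn : ∀ {u w} → Edge G u w → WConn G π (π u) (π w)
  Edge⇒WConn {u} {w} e with π u ≟ π w
  ... | yes πu≡πw rewrite πu≡πw = ε
  ... | no  πu≢πw = fwd (πu≢πw , u , w , refl , e , refl) ◅ ε

  module _ (φ : Permutation′ n) where

    ColorPreserving : Set
    ColorPreserving = ∀ v → π (φ ⟨$⟩ʳ v) ≡ π v

    colorPreserving⇒mapsOnto : ColorPreserving → (Q : Fin k → Set) → MapsOnto φ (Q ∘ π)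
    colorPreserving⇒mapsOnto col Q = preimage-closed , image-closed
      where
      preimage-closed : ∀ v → Q (π v) → Q (π (φ ⟨$⟩ʳ v))
      preimage-closed v = subst Q (sym (col v))

      image-closed : ∀ w → Q (π w) → ∃[ v ] (Q (π v) × φ ⟨$⟩ʳ v ≡ w)
      image-closed w q = φ ⟨$⟩ˡ w , subst Q πw≡πφ⁻¹w q , inverseʳ φ
        where
        πw≡πφ⁻¹w : π w ≡ π (φ ⟨$⟩ˡ w)
        πw≡πφ⁻¹w = trans (sym (cong π (inverseʳ φ))) (col (φ ⟨$⟩ˡ w))

    isAut⇒restrictionIsAut : IsAut G π φ → (P : Fin n → Set) → RestrictionIsAut G π φ P
    isAut⇒restrictionIsAut (edges , col) P = (λ u v _ _ → edges u v) , (λ v _ → col v)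

    restrictionsAreAut⇒isAut :
      (∀ x → RestrictionIsAut G π φ (InPart G π (π x))) → IsAut G π φ
    restrictionsAreAut⇒isAut restr = edges , col
      where
      col : ColorPreserving
      col v = let (_ , colᵥ) = restr v in colᵥ v ε

      edgesInPartOf : ∀ u v → InPart G π (π u) v → Edge G u v ⇔ Edge G (φ ⟨$⟩ʳ u) (φ ⟨$⟩ʳ v)
      edgesInPartOf u v uv-same-part = let (edgesᵤ , _) = restr u in edgesᵤ u v ε uv-same-part

      edges : ∀ u v → Edge G u v ⇔ Edge G (φ ⟨$⟩ʳ u) (φ ⟨$⟩ʳ v)
      edges u v = mk⇔
        (λ e → Equivalence.to (edgesInPartOf u v (Edge⇒WConn e)) e)
        (λ e → Equivalence.from
                 (edgesInPartOf u v (subst₂ (WConn G π) (col u) (col v) (Edge⇒WConn e))) e)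

mainTheorem1 : ∀ {n k} (G : Graph n) (π : Coloring n k) → Equitable G π →
    (φ : Permutation′ n) →
    IsAut G π φ ⇔
      (∀ (x : Fin n) → MapsOnto φ (InPart G π (π x)) × RestrictionIsAut G π φ (InPart G π (π x)))
mainTheorem1 G π _ φ = mk⇔ to from
  where
  to : IsAut G π φ →
       ∀ x → MapsOnto φ (InPart G π (π x)) × RestrictionIsAut G π φ (InPart G π (π x))
  to aut@(_ , col) x =
    colorPreserving⇒mapsOnto G π φ col (WConn G π (π x)) ,
    isAut⇒restrictionIsAut G π φ aut (InPart G π (π x))

  from : (∀ x → MapsOnto φ (InPart G π (π x)) × RestrictionIsAut G π φ (InPart G π (π x))) →
         IsAut G π φ
  from parts = restrictionsAreAut⇒isAut G π φ (λ x → let (_ , restr) = parts x in restr)
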